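{- Let $(G,\tau)$ be a signed graph, let $\mathbf{w}$ be a $(u,v)$-walk without unbalanced vertex terms, and let $\mathbf{w}_1,\mathbf{w}_2$ be $(v,u)$-walks. If $\mathbf{w}+\mathbf{w}_i$ is even for each $i=1,2$, then $B_{\mathbf{w}_1+\mathbf{w}_2^{ -1}}$ belongs to the ideal $\langle B_{\mathbf{w}+\mathbf{w}_1},B_{\mathbf{w}+\mathbf{w}_2}\rangle$.
   Context: Graphs are finite and simple; a sign $\tau$ of $G$ assigns $1$ or $-1$ to each pair $(e,v)$ with $v$ an endpoint of edge $e$. A walk $v_1e_1v_2\cdots e_tv_{t+1}$ has $e_i=v_iv_{i+1}$; it is a $(v_1,v_{t+1})$-walk; closed if $v_{t+1}=v_1$. $\mathbf{w}+\mathbf{w}'$ is concatenation and $\mathbf{w}^{ -1}$ the reversed walk. An internal vertex term $v_i$ is unbalanced if $\tau(e_{i-1},v_i)\tau(e_i,v_i)=1$; for a closed walk of length $\ge2$, $v_1$ is also unbalanced if $\tau(e_t,v_1)\tau(e_1,v_1)=1$. A closed walk is even if it has an even number of unbalanced vertex terms. A balanced section of a closed walk is a maximal section (consecutive terms, cyclically) with no internal unbalanced vertex term. An even closed walk $\mathbf{x}$ with an unbalanced vertex term, started at one, decomposes uniquely into consecutive balanced sections $\mathbf{x}_0,\dots,\mathbf{x}_{2k-1}$, and $B_{\mathbf{x}}=\prod_{i\text{ even}}\prod_{e\in E(\mathbf{x}_i)}e-\prod_{i\text{ odd}}\prod_{e\in E(\mathbf{x}_i)}e$ (edges with multiplicity,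 as variables of a polynomial ring over a field); if $\mathbf{x}$ has no unbalanced vertex term, $B_{\mathbf{x}}=\prod_{e\in E(\mathbf{x})}e-1$. $B_{\mathbf{x}}$ is determined up to sign. (Under the hypotheses, $\mathbf{w}_1+\mathbf{w}_2^{ -1}$ is an even closed walk.) -}

module Defs where

open import Level using (Level; _⊔_; suc)
open import Algebra.Bundles using (CommutativeRing)
open import Data.Nat as ℕ using (ℕ)
open import Data.Fin as Fin using (Fin)
open import Data.Fin.Properties as FinP using ()
open import Data.Vec as Vec using (Vec; replicate; updateAt; zipWith)
open import Data.Vec.Properties as VecP using ()
open import Data.List as List using (List; []; _∷_; _++_; map; concatMap; foldr; length)
open import Data.Product using (_×_; _,_; Σ; ∃; ∃-syntax; proj₁; proj₂)
open import Data.Sum using (_⊎_)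
open import Data.Bool using (Bool; true; false; if_then_else_; not)
open import Data.Sign as Sign using (Sign) renaming (_*_ to _*ₛ_)
open import Relation.Nullary using (¬_; yes; no)
open import Relation.Nullary.Decidable using (⌊_⌋)
open import Relation.Binary.PropositionalEquality using (_≡_; _≢_)

record Field (c ℓ : Level) : Set (suc (c ⊔ ℓ)) where
  field
    commutativeRing : CommutativeRing c ℓ
  open CommutativeRing commutativeRing public
  field
    1≉0     : ¬ (1# ≈ 0#)
    inverse : ∀ x → ¬ (x ≈ 0#) → ∃[ y ] (x * y ≈ 1#)

-- The sign τ assigns τ₁ e to (e , end₁ e) and τ₂ e to (e , end₂ e).

record SignedGraph : Set where
  field
    n m      : ℕ
    end₁ end₂ : Fin m → Fin n
    loopless : ∀ e → end₁ e ≢ end₂ e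
    simple   : ∀ e e′ →
               ((end₁ e ≡ end₁ e′ × end₂ e ≡ end₂ e′) ⊎
                (end₁ e ≡ end₂ e′ × end₂ e ≡ end₁ e′)) → e ≡ e′
    τ₁ τ₂    : Fin m → Sign

module _ (G : SignedGraph) where
  open SignedGraph G

  τ : Fin m → Fin n → Sign
  τ e v = if ⌊ v Fin.≟ end₁ e ⌋ then τ₁ e else τ₂ e

  Joins : Fin m → Fin n → Fin n → Set
  Joins e u v = (end₁ e ≡ u × end₂ e ≡ v) ⊎ (end₂ e ≡ u × end₁ e ≡ v)

  data Walk : Fin n → Fin n → Set where
    []  : ∀ {u} → Walk u u
    _∷⟨_⟩_ : ∀ {u w v} (e : Fin m) → Joins e u w → Walk w v → Walk u v

  _+w_ : ∀ {u v x} → Walk u v → Walk v x → Walk u x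
  [] +w w′ = w′
  (e ∷⟨ j ⟩ w) +w w′ = e ∷⟨ j ⟩ (w +w w′)

  joins-sym : ∀ {e u v} → Joins e u v → Joins e v u
  joins-sym (Data.Sum.inj₁ (a , b)) = Data.Sum.inj₂ (b , a)
  joins-sym (Data.Sum.inj₂ (a , b)) = Data.Sum.inj₁ (b , a)

  rev : ∀ {u v} → Walk u v → Walk v u
  rev [] = []
  rev (e ∷⟨ j ⟩ w) = rev w +w (e ∷⟨ joins-sym j ⟩ [])

  -- A step of a walk v_i e_i v_{i+1}: (e_i , τ(e_i,v_i) , τ(e_i,v_{i+1}))
  Step : Set
  Step = Fin m × Sign × Sign

  steps : ∀ {u v} → Walk u v → List Step
  steps [] = []
  steps (_∷⟨_⟩_ {u} {w} e j rest) = (e , τ e u , τ e w) ∷ steps rest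

  edges : ∀ {u v} → Walk u v → List (Fin m)
  edges w = map proj₁ (steps w)

  -- the vertex term between steps (e , s , t) and (e′ , s′ , t′) is
  -- unbalanced iff τ(e,v)τ(e′,v) = t s′ = 1
  unbalancedJunction : Step → Step → Bool
  unbalancedJunction (_ , _ , t) (_ , s′ , _) with t *ₛ s′
  ... | Sign.+ = true
  ... | Sign.- = false

  internalFlags : List Step → List Bool
  internalFlags [] = []
  internalFlags (x ∷ []) = []
  internalFlags (x ∷ y ∷ xs) = unbalancedJunction x y ∷ internalFlags (y ∷ xs)

  last : Step → List Step → Step
  last x [] = x
  last x (y ∷ ys) = last y ys

  -- flags of all vertex terms of a closed walk (v₁ counted iff length ≥ 2)
  closedFlags : List Step → List Bool
  closedFlags [] = []
  closedFlags (x ∷ []) = []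
  closedFlags (x ∷ y ∷ xs) =
    unbalancedJunction (last y xs) x ∷ internalFlags (x ∷ y ∷ xs)

  count : List Bool → ℕ
  count [] = 0
  count (true ∷ bs) = ℕ.suc (count bs)
  count (false ∷ bs) = count bs

  NoUnbalanced : ∀ {u v} → Walk u v → Set
  NoUnbalanced w = count (internalFlags (steps w)) ≡ 0

  IsEven : ∀ {u} → Walk u u → Set
  IsEven w = ∃[ k ] (count (closedFlags (steps w)) ≡ k ℕ.+ k)

  -- Split the edges of a closed walk into those lying in even-indexed and
  -- odd-indexed balanced sections: scanning from the start, the section
  -- parity flips at every unbalanced internal vertex term.  (For an even
  -- closed walk this is the alternating section decomposition, up to the
  -- choice of the starting unbalanced vertex, i.e. up to the sign of B.)
  sections : Bool → List Step → List (Fin m) × List (Fin m)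
  sections p [] = [] , []
  sections p (x ∷ []) = add p x ([] , [])
    where
    add : Bool → Step → List (Fin m) × List (Fin m) → List (Fin m) × List (Fin m)
    add false (e , _) (ev , od) = e ∷ ev , od
    add true  (e , _) (ev , od) = ev , e ∷ od
  sections p (x ∷ y ∷ xs) =
    add p x (sections (if unbalancedJunction x y then not p else p) (y ∷ xs))
    where
    add : Bool → Step → List (Fin m) × List (Fin m) → List (Fin m) × List (Fin m)
    add false (e , _) (ev , od) = e ∷ ev , od
    add true  (e , _) (ev , od) = ev , e ∷ od

module Poly {c ℓ} (K : Field c ℓ) (m : ℕ) where
  private module K = Field K

  Monomial : Set
  Monomial = Vec ℕ m

  Polynomial : Set c
  Polynomial = List (K.Carrier × Monomial)

  monomial : List (Fin m) → Monomial
  monomial = foldr (λ e μ → updateAt μ e ℕ.suc) (replicate m 0)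

  coeff : Polynomial → Monomial → K.Carrier
  coeff p μ = foldr (λ { (a , ν) acc →
                  if ⌊ VecP.≡-dec ℕ._≟_ ν μ ⌋ then a K.+ acc else acc }) K.0# p

  _≈ₚ_ : Polynomial → Polynomial → Set ℓ
  p ≈ₚ q = ∀ μ → coeff p μ K.≈ coeff q μ

  _+ₚ_ : Polynomial → Polynomial → Polynomial
  p +ₚ q = p ++ q

  _*ₚ_ : Polynomial → Polynomial → Polynomial
  p *ₚ q = concatMap (λ { (a , μ) → map (λ { (b , ν) → (a K.* b , zipWith ℕ._+_ μ ν) }) q }) p

  binomial : List (Fin m) → List (Fin m) → Polynomial
  binomial es fs = (K.1# , monomial es) ∷ (K.- K.1# , monomial fs) ∷ []

  InIdeal₂ : Polynomial → Polynomial → Polynomial → Set (c ⊔ ℓ)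
  InIdeal₂ p q₁ q₂ = ∃[ f ] ∃[ g ] (p ≈ₚ ((f *ₚ q₁) +ₚ (g *ₚ q₂)))

-- B_𝐱 for a closed walk 𝐱 of G, as a polynomial in K[E(G)] (up to sign).
-- If 𝐱 has no unbalanced vertex term all edges fall in the even part and
-- this is ∏_{e ∈ E(𝐱)} e − 1, as in the paper.
B : ∀ {c ℓ} (K : Field c ℓ) (G : SignedGraph) {u : Fin (SignedGraph.n G)} →
    Walk G u u → Poly.Polynomial K (SignedGraph.m G)
B K G w = let s = sections G false (steps G w) in
          Poly.binomial K (SignedGraph.m G) (proj₁ s) (proj₂ s)

-- Write the B of a closed walk as x^a − x^b, with a and b the exponent vectors of its even and
-- odd balanced sections. As w has no unbalanced vertex term it lies in a single section, so
-- B_{w+wᵢ} = x^w x^{aᵢ} − x^{bᵢ}, where (aᵢ, bᵢ) is the section split of wᵢ inside w + wᵢ.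
-- Evenness of w + w₁ and w + w₂, together with the fact that the three sign products at u
-- multiply to a square, forces the sections of w₁ + w₂⁻¹ to be, up to a global swap, those of
-- w₁ in w + w₁ and the opposite of those of w₂ in w + w₂. Hence B_{w₁+w₂⁻¹} is
-- ±(x^{a₁+b₂} − x^{b₁+a₂}) = ±(x^{a₂} B_{w+w₁} − x^{a₁} B_{w+w₂}). When w, w₁ or w₂ is trivial
-- the parities are unconstrained, but then a similar two-term combination works.

module Submission where

open import Defs
open import Data.Nat as ℕ using (ℕ; zero; suc)
import Data.Nat.Properties as ℕ
open import Data.Fin as Fin using (Fin)
open import Data.Vec as Vec using (Vec; []; _∷_; replicate; updateAt; zipWith)
import Data.Vec.Properties as Vec
open import Data.List as List
  using (List; []; _∷_; _++_; _∷ʳ_; map; reverse; initLast; _∷ʳ′_)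
import Data.List.Properties as List
open import Data.Product using (_×_; _,_; proj₁; proj₂; swap)
open import Data.Sum as Sum using (_⊎_; inj₁; inj₂)
open import Data.Bool using (Bool; true; false; not; _xor_; if_then_else_)
open import Data.Bool.Properties
  using (xor-assoc; xor-comm; xor-identityʳ; not-involutive; xor-∧-commutativeRing; if-float)
import Data.Sign as Sign
open import Function using (_∘_)
open import Relation.Nullary using (yes; no)
open import Relation.Binary.PropositionalEquality
  using (_≡_; refl; sym; trans; cong; cong₂; subst; module ≡-Reasoning)
open import Algebra.Bundles using (CommutativeRing)
import Algebra.Properties.Ring as RingProperties
import Algebra.Solver.CommutativeMonoid as CommutativeMonoidSolver

parity : List Bool → Bool
parity = List.foldr _xor_ false

xor≡false⇒≡ : ∀ {x y} → x xor y ≡ false → x ≡ y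
xor≡false⇒≡ {false} {false} _ = refl
xor≡false⇒≡ {true}  {true}  _ = refl

xor≡true⇒≡not : ∀ {x y} → x xor y ≡ true → y ≡ not x
xor≡true⇒≡not {false} {true}  _ = refl
xor≡true⇒≡not {true}  {false} _ = refl

xor-regroup : ∀ π₁ π₂ i₁ i₂ q →
              π₁ xor (π₂ xor ((i₁ xor q) xor i₂)) ≡ (π₁ xor i₁) xor ((π₂ xor i₂) xor q)
xor-regroup = solve 5 (λ π₁ π₂ i₁ i₂ q →
  π₁ ⊕ (π₂ ⊕ ((i₁ ⊕ q) ⊕ i₂)) ⊜ (π₁ ⊕ i₁) ⊕ ((π₂ ⊕ i₂) ⊕ q)) refl
  where open CommutativeMonoidSolver (CommutativeRing.+-commutativeMonoid xor-∧-commutativeRing)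

isOdd : ℕ → Bool
isOdd zero    = false
isOdd (suc n) = not (isOdd n)

isOdd-double : ∀ k → isOdd (k ℕ.+ k) ≡ false
isOdd-double zero    = refl
isOdd-double (suc k) rewrite ℕ.+-suc k k | not-involutive (isOdd (k ℕ.+ k)) = isOdd-double k

module Exponents (m : ℕ) where

  infixr 6 _⊕_ _⊞_

  _⊕_ : Vec ℕ m → Vec ℕ m → Vec ℕ m
  _⊕_ = zipWith ℕ._+_

  0ᵥ : Vec ℕ m
  0ᵥ = replicate m 0

  ⊕-comm : ∀ a b → a ⊕ b ≡ b ⊕ a
  ⊕-comm = Vec.zipWith-comm ℕ.+-comm

  ⊕-assoc : ∀ a b c → (a ⊕ b) ⊕ c ≡ a ⊕ (b ⊕ c)
  ⊕-assoc = Vec.zipWith-assoc ℕ.+-assoc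

  ⊕-identityˡ : ∀ a → 0ᵥ ⊕ a ≡ a
  ⊕-identityˡ = Vec.zipWith-identityˡ ℕ.+-identityˡ

  ⊕-identityʳ : ∀ a → a ⊕ 0ᵥ ≡ a
  ⊕-identityʳ = Vec.zipWith-identityʳ ℕ.+-identityʳ

  ⊕-middle : ∀ a w b → a ⊕ (w ⊕ b) ≡ b ⊕ (w ⊕ a)
  ⊕-middle a w b = begin
    a ⊕ (w ⊕ b)  ≡⟨ sym (⊕-assoc a w b) ⟩
    (a ⊕ w) ⊕ b  ≡⟨ ⊕-comm (a ⊕ w) b ⟩
    b ⊕ (a ⊕ w)  ≡⟨ cong (b ⊕_) (⊕-comm a w) ⟩
    b ⊕ (w ⊕ a)  ∎
    where open ≡-Reasoning

  updateAt-suc-⊕ : ∀ {n} (a b : Vec ℕ n) i →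
                   updateAt (zipWith ℕ._+_ a b) i suc ≡ zipWith ℕ._+_ (updateAt a i suc) b
  updateAt-suc-⊕ (x ∷ a) (y ∷ b) Fin.zero    = refl
  updateAt-suc-⊕ (x ∷ a) (y ∷ b) (Fin.suc i) = cong (x ℕ.+ y ∷_) (updateAt-suc-⊕ a b i)

  ExponentPair : Set
  ExponentPair = Vec ℕ m × Vec ℕ m

  𝟘 : ExponentPair
  𝟘 = 0ᵥ , 0ᵥ

  _⊞_ : ExponentPair → ExponentPair → ExponentPair
  (a , b) ⊞ (c , d) = a ⊕ c , b ⊕ d

  ⊞-comm : ∀ P Q → P ⊞ Q ≡ Q ⊞ P
  ⊞-comm (a , b) (c , d) = cong₂ _,_ (⊕-comm a c) (⊕-comm b d)

  ⊞-assoc : ∀ P Q R → (P ⊞ Q) ⊞ R ≡ P ⊞ (Q ⊞ R)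
  ⊞-assoc (a , b) (c , d) (e , f) = cong₂ _,_ (⊕-assoc a c e) (⊕-assoc b d f)

  ⊞-identityˡ : ∀ P → 𝟘 ⊞ P ≡ P
  ⊞-identityˡ (a , b) = cong₂ _,_ (⊕-identityˡ a) (⊕-identityˡ b)

  ⊞-identityʳ : ∀ P → P ⊞ 𝟘 ≡ P
  ⊞-identityʳ (a , b) = cong₂ _,_ (⊕-identityʳ a) (⊕-identityʳ b)

  swapIf : Bool → ExponentPair → ExponentPair
  swapIf b P = if b then swap P else P

  swapIf-⊞ : ∀ b P Q → swapIf b (P ⊞ Q) ≡ swapIf b P ⊞ swapIf b Q
  swapIf-⊞ false P Q = refl
  swapIf-⊞ true  P Q = refl

  swapIf-swapIf : ∀ a b P → swapIf a (swapIf b P) ≡ swapIf (a xor b) P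
  swapIf-swapIf false b    P = refl
  swapIf-swapIf true false P = refl
  swapIf-swapIf true true  P = refl

  swapIf-xor-cancel : ∀ a b P → swapIf (b xor a) (swapIf b P) ≡ swapIf a P
  swapIf-xor-cancel false false P = refl
  swapIf-xor-cancel false true  P = refl
  swapIf-xor-cancel true  false P = refl
  swapIf-xor-cancel true  true  P = refl

  swapIf-involutive : ∀ b P → swapIf b (swapIf b P) ≡ P
  swapIf-involutive false P = refl
  swapIf-involutive true  P = refl

  swapIf-≡𝟘 : ∀ b {P} → P ≡ 𝟘 → swapIf b P ≡ 𝟘
  swapIf-≡𝟘 false refl = refl
  swapIf-≡𝟘 true  refl = refl

  shift : Vec ℕ m → ExponentPair → ExponentPair
  shift f (a , b) = f ⊕ a , f ⊕ b

  shiftEven : Vec ℕ m → ExponentPair → ExponentPair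
  shiftEven w (a , b) = w ⊕ a , b

  shiftEven-identity : ∀ P → shiftEven 0ᵥ P ≡ P
  shiftEven-identity (a , b) = cong (_, b) (⊕-identityˡ a)

  ⊞-shiftEven : ∀ W P → proj₂ W ≡ 0ᵥ → W ⊞ P ≡ shiftEven (proj₁ W) P
  ⊞-shiftEven (w , _) (a , b) refl = cong (w ⊕ a ,_) (⊕-identityˡ b)

module BinomialIdeals {c ℓ} (K : Field c ℓ) (m : ℕ) where
  module K = Field K
  open K hiding (refl; sym; trans)
  open RingProperties ring using (-1*x≈-x; -‿involutive)
  open Poly K m using (Polynomial; coeff; _≈ₚ_; _*ₚ_; _+ₚ_; InIdeal₂)
  open Exponents m
  open import Relation.Binary.Reasoning.Setoid setoid

  binomial : ExponentPair → Polynomial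
  binomial (a , b) = (1# , a) ∷ (- 1# , b) ∷ []

  sign : Bool → Carrier
  sign false = 1#
  sign true  = - 1#

  ≈ₚ-sym : ∀ p q → p ≈ₚ q → q ≈ₚ p
  ≈ₚ-sym _ _ p≈q μ = K.sym (p≈q μ)

  ∷-cong : ∀ {a b} ν p q → a ≈ b → p ≈ₚ q → ((a , ν) ∷ p) ≈ₚ ((b , ν) ∷ q)
  ∷-cong ν _ _ a≈b p≈q μ with Vec.≡-dec ℕ._≟_ ν μ
  ... | yes _ = +-cong a≈b (p≈q μ)
  ... | no  _ = p≈q μ

  ∷-swap : ∀ s t p → (s ∷ t ∷ p) ≈ₚ (t ∷ s ∷ p)
  ∷-swap (a , ν) (b , ν′) p μ
    with Vec.≡-dec ℕ._≟_ ν μ | Vec.≡-dec ℕ._≟_ ν′ μ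
  ... | yes _ | yes _ = begin
    a + (b + coeff p μ)  ≈⟨ +-assoc a b _ ⟨
    (a + b) + coeff p μ  ≈⟨ +-congʳ (+-comm a b) ⟩
    (b + a) + coeff p μ  ≈⟨ +-assoc b a _ ⟩
    b + (a + coeff p μ)  ∎
  ... | yes _ | no  _ = K.refl
  ... | no  _ | yes _ = K.refl
  ... | no  _ | no  _ = K.refl

  ∷-cancel : ∀ {a b} ν p → a + b ≈ 0# → ((a , ν) ∷ (b , ν) ∷ p) ≈ₚ p
  ∷-cancel {a} {b} ν p a+b≈0 μ with Vec.≡-dec ℕ._≟_ ν μ
  ... | yes _ = begin
    a + (b + coeff p μ)  ≈⟨ +-assoc a b _ ⟨
    (a + b) + coeff p μ  ≈⟨ +-congʳ a+b≈0 ⟩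
    0# + coeff p μ       ≈⟨ +-identityˡ _ ⟩
    coeff p μ            ∎
  ... | no  _ = K.refl

  coeff-++ : ∀ p q μ → coeff (p ++ q) μ ≈ coeff p μ + coeff q μ
  coeff-++ []            q μ = K.sym (+-identityˡ _)
  coeff-++ ((a , ν) ∷ p) q μ with Vec.≡-dec ℕ._≟_ ν μ
  ... | yes _ = K.trans (+-congˡ (coeff-++ p q μ)) (K.sym (+-assoc a _ _))
  ... | no  _ = coeff-++ p q μ

  binomial-split : ∀ s t u → binomial (s , u) ≈ₚ (binomial (s , t) ++ binomial (t , u))
  binomial-split s t u =
    ∷-cong s ((- 1# , u) ∷ []) ((- 1# , t) ∷ binomial (t , u)) K.refl
      (≈ₚ-sym ((- 1# , t) ∷ binomial (t , u)) ((- 1# , u) ∷ [])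
              (∷-cancel t ((- 1# , u) ∷ []) (-‿inverseˡ 1#)))

  monomial-*-binomial : ∀ b f P →
                        (((sign b , f) ∷ []) *ₚ binomial P) ≈ₚ binomial (shift f (swapIf b P))
  monomial-*-binomial false f (x , y) =
    ∷-cong (f ⊕ x) ((1# * - 1# , f ⊕ y) ∷ []) ((- 1# , f ⊕ y) ∷ []) (*-identityˡ 1#)
      (∷-cong (f ⊕ y) [] [] (*-identityˡ (- 1#)) (λ _ → K.refl))
  monomial-*-binomial true f (x , y) μ =
    K.trans (∷-swap (- 1# * 1# , f ⊕ x) (- 1# * - 1# , f ⊕ y) [] μ)
    (∷-cong (f ⊕ y) ((- 1# * 1# , f ⊕ x) ∷ []) ((- 1# , f ⊕ x) ∷ []) -1*-1≈1
      (∷-cong (f ⊕ x) [] [] (*-identityʳ (- 1#)) (λ _ → K.refl)) μ)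
    where -1*-1≈1 = K.trans (-1*x≈-x (- 1#)) (-‿involutive 1#)

  InIdeal₂-resp-≡ : ∀ P Q₁ Q₂ {P′ Q₁′ Q₂′} → P ≡ P′ → Q₁ ≡ Q₁′ → Q₂ ≡ Q₂′ →
                    InIdeal₂ (binomial P′) (binomial Q₁′) (binomial Q₂′) →
                    InIdeal₂ (binomial P) (binomial Q₁) (binomial Q₂)
  InIdeal₂-resp-≡ _ _ _ refl refl refl I = I

  InIdeal₂-comm : ∀ p q₁ q₂ → InIdeal₂ p q₁ q₂ → InIdeal₂ p q₂ q₁
  InIdeal₂-comm _ _ _ (f , g , p≈) = g , f , λ μ → K.trans (p≈ μ) (begin
    coeff (f *ₚ _ ++ g *ₚ _) μ         ≈⟨ coeff-++ (f *ₚ _) _ μ ⟩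
    coeff (f *ₚ _) μ + coeff (g *ₚ _) μ ≈⟨ +-comm _ _ ⟩
    coeff (g *ₚ _) μ + coeff (f *ₚ _) μ ≈⟨ coeff-++ (g *ₚ _) _ μ ⟨
    coeff (g *ₚ _ ++ f *ₚ _) μ         ∎)

  -- x^s − x^u = (x^s − x^t) + (x^t − x^u), with each summand ± a monomial times a generator.
  split-∈-ideal : ∀ Q₁ Q₂ s t u b f b′ f′ →
                  (s , t) ≡ shift f (swapIf b Q₁) → (t , u) ≡ shift f′ (swapIf b′ Q₂) →
                  InIdeal₂ (binomial (s , u)) (binomial Q₁) (binomial Q₂)
  split-∈-ideal Q₁ Q₂ s t u b f b′ f′ st≡ tu≡ = F , F′ , λ μ → begin
    coeff (binomial (s , u)) μ
      ≈⟨ binomial-split s t u μ ⟩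
    coeff (binomial (s , t) ++ binomial (t , u)) μ
      ≈⟨ coeff-++ (binomial (s , t)) (binomial (t , u)) μ ⟩
    coeff (binomial (s , t)) μ + coeff (binomial (t , u)) μ
      ≡⟨ cong₂ (λ P P′ → coeff (binomial P) μ + coeff (binomial P′) μ) st≡ tu≡ ⟩
    coeff (binomial (shift f (swapIf b Q₁))) μ + coeff (binomial (shift f′ (swapIf b′ Q₂))) μ
      ≈⟨ +-cong (monomial-*-binomial b f Q₁ μ) (monomial-*-binomial b′ f′ Q₂ μ) ⟨
    coeff (F *ₚ binomial Q₁) μ + coeff (F′ *ₚ binomial Q₂) μ
      ≈⟨ coeff-++ (F *ₚ binomial Q₁) (F′ *ₚ binomial Q₂) μ ⟨
    coeff ((F *ₚ binomial Q₁) +ₚ (F′ *ₚ binomial Q₂)) μ ∎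
    where
    F  = (sign b , f) ∷ []
    F′ = (sign b′ , f′) ∷ []

  split-∈-ideal′ : ∀ Q₁ Q₂ s t u b f b′ f′ →
                   (s , t) ≡ shift f (swapIf b Q₂) → (t , u) ≡ shift f′ (swapIf b′ Q₁) →
                   InIdeal₂ (binomial (s , u)) (binomial Q₁) (binomial Q₂)
  split-∈-ideal′ Q₁ Q₂ s t u b f b′ f′ st≡ tu≡ =
    InIdeal₂-comm (binomial (s , u)) (binomial Q₂) (binomial Q₁)
      (split-∈-ideal Q₂ Q₁ s t u b f b′ f′ st≡ tu≡)

  opposite-swaps-∈-ideal : ∀ b w Y₁ Y₂ →
    InIdeal₂ (binomial (swapIf b Y₁ ⊞ swapIf (not b) Y₂))
             (binomial (shiftEven w Y₁)) (binomial (shiftEven w Y₂))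
  opposite-swaps-∈-ideal false w (a₁ , b₁) (a₂ , b₂) =
    split-∈-ideal′ (w ⊕ a₁ , b₁) (w ⊕ a₂ , b₂) (a₁ ⊕ b₂) (a₁ ⊕ (w ⊕ a₂)) (b₁ ⊕ a₂)
      true a₁ false a₂
      refl (cong₂ _,_ (⊕-middle a₁ w a₂) (⊕-comm b₁ a₂))
  opposite-swaps-∈-ideal true w (a₁ , b₁) (a₂ , b₂) =
    split-∈-ideal (w ⊕ a₁ , b₁) (w ⊕ a₂ , b₂) (b₁ ⊕ a₂) (a₂ ⊕ (w ⊕ a₁)) (a₁ ⊕ b₂)
      true a₂ false a₁
      (cong (_, _) (⊕-comm b₁ a₂)) (cong (_, _) (⊕-middle a₂ w a₁))

  equal-swaps-∈-ideal : ∀ b Y₁ Y₂ →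
    InIdeal₂ (binomial (swapIf b Y₁ ⊞ swapIf b Y₂)) (binomial Y₁) (binomial Y₂)
  equal-swaps-∈-ideal false (a₁ , b₁) (a₂ , b₂) =
    split-∈-ideal (a₁ , b₁) (a₂ , b₂) (a₁ ⊕ a₂) (a₂ ⊕ b₁) (b₁ ⊕ b₂) false a₂ false b₁
      (cong (_, _) (⊕-comm a₁ a₂)) (cong (_, _) (⊕-comm a₂ b₁))
  equal-swaps-∈-ideal true (a₁ , b₁) (a₂ , b₂) =
    split-∈-ideal′ (a₁ , b₁) (a₂ , b₂) (b₁ ⊕ b₂) (b₁ ⊕ a₂) (a₁ ⊕ a₂) true b₁ true a₂
      refl (cong₂ _,_ (⊕-comm b₁ a₂) (⊕-comm a₁ a₂))

  trivial-shift-∈-ideal : ∀ b Y₁ Y₂ →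
    InIdeal₂ (binomial (swapIf b Y₁ ⊞ swapIf b Y₂))
             (binomial (shiftEven 0ᵥ Y₁)) (binomial (shiftEven 0ᵥ Y₂))
  trivial-shift-∈-ideal b Y₁ Y₂ =
    InIdeal₂-resp-≡ (swapIf b Y₁ ⊞ swapIf b Y₂) (shiftEven 0ᵥ Y₁) (shiftEven 0ᵥ Y₂)
      refl (shiftEven-identity Y₁) (shiftEven-identity Y₂)
      (equal-swaps-∈-ideal b Y₁ Y₂)

  swaps-∈-ideal : ∀ w b₁ b₂ Y₁ Y₂ → w ≡ 0ᵥ ⊎ Y₁ ≡ 𝟘 ⊎ Y₂ ≡ 𝟘 ⊎ b₂ ≡ not b₁ →
    InIdeal₂ (binomial (swapIf b₁ Y₁ ⊞ swapIf b₂ Y₂))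
             (binomial (shiftEven w Y₁)) (binomial (shiftEven w Y₂))
  swaps-∈-ideal w false true  Y₁ Y₂ _ = opposite-swaps-∈-ideal false w Y₁ Y₂
  swaps-∈-ideal w true  false Y₁ Y₂ _ = opposite-swaps-∈-ideal true  w Y₁ Y₂
  swaps-∈-ideal .0ᵥ false false Y₁ Y₂ (inj₁ refl) = trivial-shift-∈-ideal false Y₁ Y₂
  swaps-∈-ideal .0ᵥ true  true  Y₁ Y₂ (inj₁ refl) = trivial-shift-∈-ideal true  Y₁ Y₂
  swaps-∈-ideal w false false .𝟘 Y₂ (inj₂ (inj₁ refl)) = opposite-swaps-∈-ideal true  w 𝟘 Y₂
  swaps-∈-ideal w true  true  .𝟘 Y₂ (inj₂ (inj₁ refl)) = opposite-swaps-∈-ideal false w 𝟘 Y₂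
  swaps-∈-ideal w false false Y₁ .𝟘 (inj₂ (inj₂ (inj₁ refl))) = opposite-swaps-∈-ideal false w Y₁ 𝟘
  swaps-∈-ideal w true  true  Y₁ .𝟘 (inj₂ (inj₂ (inj₁ refl))) = opposite-swaps-∈-ideal true  w Y₁ 𝟘
  swaps-∈-ideal w false false Y₁ Y₂ (inj₂ (inj₂ (inj₂ ())))
  swaps-∈-ideal w true  true  Y₁ Y₂ (inj₂ (inj₂ (inj₂ ())))

  binomial-∈-ideal : ∀ w π₁ π₂ κ X₁ X₂ →
    w ≡ 0ᵥ ⊎ X₁ ≡ 𝟘 ⊎ X₂ ≡ 𝟘 ⊎ π₁ xor (π₂ xor κ) ≡ true →
    InIdeal₂ (binomial (X₁ ⊞ swapIf κ X₂))
             (binomial (shiftEven w (swapIf π₁ X₁))) (binomial (shiftEven w (swapIf π₂ X₂)))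
  binomial-∈-ideal w π₁ π₂ κ X₁ X₂ admissible =
    InIdeal₂-resp-≡ (X₁ ⊞ swapIf κ X₂) (shiftEven w Y₁) (shiftEven w Y₂)
      (cong₂ _⊞_ (sym (swapIf-involutive π₁ X₁)) (sym (swapIf-xor-cancel κ π₂ X₂))) refl refl
      (swaps-∈-ideal w π₁ (π₂ xor κ) Y₁ Y₂
        (Sum.map₂ (Sum.map (swapIf-≡𝟘 π₁) (Sum.map (swapIf-≡𝟘 π₂) xor≡true⇒≡not)) admissible))
    where
    Y₁ = swapIf π₁ X₁
    Y₂ = swapIf π₂ X₂

module Sections {c ℓ} (K : Field c ℓ) (G : SignedGraph) where
  open SignedGraph G using (m)
  open Poly K m using (monomial; InIdeal₂)
  open Exponents m
  open BinomialIdeals K m using (binomial; InIdeal₂-resp-≡; binomial-∈-ideal)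

  J : Step G → Step G → Bool
  J = unbalancedJunction G

  flags : List (Step G) → List Bool
  flags = internalFlags G

  parity≡isOdd∘count : ∀ bs → parity bs ≡ isOdd (count G bs)
  parity≡isOdd∘count []           = refl
  parity≡isOdd∘count (true  ∷ bs) = cong not (parity≡isOdd∘count bs)
  parity≡isOdd∘count (false ∷ bs) = parity≡isOdd∘count bs

  even-count⇒parity≡false : ∀ bs k → count G bs ≡ k ℕ.+ k → parity bs ≡ false
  even-count⇒parity≡false bs k e =
    trans (parity≡isOdd∘count bs) (trans (cong isOdd e) (isOdd-double k))

  junction : List (Step G) → List (Step G) → Bool
  junction []           _       = false
  junction (x ∷ [])     []      = false
  junction (x ∷ [])     (y ∷ _) = J x y
  junction (_ ∷ x ∷ xs) ys      = junction (x ∷ xs) ys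

  -- The parity of the balanced section in which ys begins inside xs ++ ys.
  entryParity : List (Step G) → List (Step G) → Bool
  entryParity xs ys = parity (flags xs) xor junction xs ys

  flipStep : Step G → Step G
  flipStep (e , s , t) = e , t , s

  reverseSteps : List (Step G) → List (Step G)
  reverseSteps L = reverse (map flipStep L)

  -- The exponent vectors of the even and odd balanced sections, the first step lying in a section
  -- of parity p; B of a closed walk w is binomial (exponents (steps G w)).
  exponentsFrom : Bool → List (Step G) → ExponentPair
  exponentsFrom p L = monomial (proj₁ (sections G p L)) , monomial (proj₂ (sections G p L))

  exponents : List (Step G) → ExponentPair
  exponents = exponentsFrom false

  monomial-∷ : ∀ e es → monomial (e ∷ es) ≡ monomial (e ∷ []) ⊕ monomial es
  monomial-∷ e es = trans (cong (λ v → updateAt v e suc) (sym (⊕-identityˡ (monomial es))))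
                          (updateAt-suc-⊕ 0ᵥ (monomial es) e)

  exponentsFrom-∷-∷ : ∀ p x y L → exponentsFrom p (x ∷ y ∷ L) ≡
    exponentsFrom p (x ∷ []) ⊞ exponentsFrom (if J x y then not p else p) (y ∷ L)
  exponentsFrom-∷-∷ false x y L =
    cong₂ _,_ (monomial-∷ (proj₁ x) (proj₁ (sections G (if J x y then true else false) (y ∷ L))))
              (sym (⊕-identityˡ _))
  exponentsFrom-∷-∷ true  x y L =
    cong₂ _,_ (sym (⊕-identityˡ _))
              (monomial-∷ (proj₁ x) (proj₂ (sections G (if J x y then false else true) (y ∷ L))))

  exponentsFrom-not : ∀ p L → exponentsFrom (not p) L ≡ swap (exponentsFrom p L)
  exponentsFrom-not p     []          = refl
  exponentsFrom-not false (x ∷ [])    = refl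
  exponentsFrom-not true  (x ∷ [])    = refl
  exponentsFrom-not p     (x ∷ y ∷ L) = begin
    exponentsFrom (not p) (x ∷ y ∷ L)
      ≡⟨ exponentsFrom-∷-∷ (not p) x y L ⟩
    exponentsFrom (not p) (x ∷ []) ⊞ exponentsFrom (if J x y then not (not p) else not p) (y ∷ L)
      ≡⟨ cong (λ q → exponentsFrom (not p) (x ∷ []) ⊞ exponentsFrom q (y ∷ L))
              (sym (if-float not (J x y))) ⟩
    exponentsFrom (not p) (x ∷ []) ⊞ exponentsFrom (not q) (y ∷ L)
      ≡⟨ cong₂ _⊞_ (single p) (exponentsFrom-not q (y ∷ L)) ⟩
    swap (exponentsFrom p (x ∷ [])) ⊞ swap (exponentsFrom q (y ∷ L))
      ≡⟨ cong swap (exponentsFrom-∷-∷ p x y L) ⟨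
    swap (exponentsFrom p (x ∷ y ∷ L)) ∎
    where
    open ≡-Reasoning
    q = if J x y then not p else p
    single : ∀ p → exponentsFrom (not p) (x ∷ []) ≡ swap (exponentsFrom p (x ∷ []))
    single false = refl
    single true  = refl

  exponents-∷-∷ : ∀ x y L →
    exponents (x ∷ y ∷ L) ≡ exponents (x ∷ []) ⊞ swapIf (J x y) (exponents (y ∷ L))
  exponents-∷-∷ x y L with J x y | exponentsFrom-∷-∷ false x y L
  ... | false | unfold = unfold
  ... | true  | unfold =
    trans unfold (cong (exponents (x ∷ []) ⊞_) (exponentsFrom-not false (y ∷ L)))

  exponents-++ : ∀ xs ys →
    exponents (xs ++ ys) ≡ exponents xs ⊞ swapIf (entryParity xs ys) (exponents ys)
  exponents-++ []            ys       = sym (⊞-identityˡ _)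
  exponents-++ (x ∷ [])      []       = sym (⊞-identityʳ _)
  exponents-++ (x ∷ [])      (y ∷ ys) = exponents-∷-∷ x y ys
  exponents-++ (x ∷ x′ ∷ xs) ys       = begin
    exponents (x ∷ x′ ∷ xs ++ ys)
      ≡⟨ exponents-∷-∷ x x′ (xs ++ ys) ⟩
    exponents (x ∷ []) ⊞ swapIf j (exponents (x′ ∷ xs ++ ys))
      ≡⟨ cong (λ P → exponents (x ∷ []) ⊞ swapIf j P) (exponents-++ (x′ ∷ xs) ys) ⟩
    exponents (x ∷ []) ⊞ swapIf j (exponents (x′ ∷ xs) ⊞ swapIf π (exponents ys))
      ≡⟨ cong (exponents (x ∷ []) ⊞_) (swapIf-⊞ j _ _) ⟩
    exponents (x ∷ []) ⊞ (swapIf j (exponents (x′ ∷ xs)) ⊞ swapIf j (swapIf π (exponents ys)))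
      ≡⟨ ⊞-assoc _ _ _ ⟨
    (exponents (x ∷ []) ⊞ swapIf j (exponents (x′ ∷ xs))) ⊞ swapIf j (swapIf π (exponents ys))
      ≡⟨ cong₂ _⊞_ (exponents-∷-∷ x x′ xs) (sym (swapIf-swapIf j π (exponents ys))) ⟨
    exponents (x ∷ x′ ∷ xs) ⊞ swapIf (j xor π) (exponents ys)
      ≡⟨ cong (λ b → exponents (x ∷ x′ ∷ xs) ⊞ swapIf b (exponents ys))
              (xor-assoc j (parity (flags (x′ ∷ xs))) (junction (x′ ∷ xs) ys)) ⟨
    exponents (x ∷ x′ ∷ xs) ⊞ swapIf (entryParity (x ∷ x′ ∷ xs) ys) (exponents ys) ∎
    where
    open ≡-Reasoning
    j = J x x′
    π = entryParity (x′ ∷ xs) ys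

  parity-flags-++ : ∀ xs ys →
    parity (flags (xs ++ ys)) ≡ entryParity xs ys xor parity (flags ys)
  parity-flags-++ []            ys       = refl
  parity-flags-++ (x ∷ [])      []       = refl
  parity-flags-++ (x ∷ [])      (y ∷ ys) = refl
  parity-flags-++ (x ∷ x′ ∷ xs) ys       = begin
    J x x′ xor parity (flags (x′ ∷ xs ++ ys))
      ≡⟨ cong (J x x′ xor_) (parity-flags-++ (x′ ∷ xs) ys) ⟩
    J x x′ xor ((P xor j) xor Q)
      ≡⟨ xor-assoc (J x x′) (P xor j) Q ⟨
    (J x x′ xor (P xor j)) xor Q
      ≡⟨ cong (_xor Q) (xor-assoc (J x x′) P j) ⟨
    ((J x x′ xor P) xor j) xor Q ∎
    where
    open ≡-Reasoning
    P = parity (flags (x′ ∷ xs))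
    j = junction (x′ ∷ xs) ys
    Q = parity (flags ys)

  proj₂-exponents-noFlags : ∀ L → count G (flags L) ≡ 0 → proj₂ (exponents L) ≡ 0ᵥ
  proj₂-exponents-noFlags []          _ = refl
  proj₂-exponents-noFlags (x ∷ [])    _ = refl
  proj₂-exponents-noFlags (x ∷ y ∷ L) noFlags =
    trans (cong proj₂ (exponents-∷-∷ x y L))
          (balanced (J x y) noFlags (proj₂-exponents-noFlags (y ∷ L)))
    where
    balanced : ∀ b → count G (b ∷ flags (y ∷ L)) ≡ 0 →
               (count G (flags (y ∷ L)) ≡ 0 → proj₂ (exponents (y ∷ L)) ≡ 0ᵥ) →
               0ᵥ ⊕ proj₂ (swapIf b (exponents (y ∷ L))) ≡ 0ᵥ
    balanced false noFlags′ rest = trans (⊕-identityˡ _) (rest noFlags′)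
    balanced true  ()       _

  exponents-++-noFlags : ∀ Sw S → count G (flags Sw) ≡ 0 →
    exponents (Sw ++ S) ≡ shiftEven (proj₁ (exponents Sw)) (swapIf (entryParity Sw S) (exponents S))
  exponents-++-noFlags Sw S noFlags =
    trans (exponents-++ Sw S) (⊞-shiftEven (exponents Sw) _ (proj₂-exponents-noFlags Sw noFlags))

  J-flip : ∀ x y → J (flipStep y) (flipStep x) ≡ J x y
  J-flip (_ , _ , Sign.+) (_ , Sign.+ , _) = refl
  J-flip (_ , _ , Sign.+) (_ , Sign.- , _) = refl
  J-flip (_ , _ , Sign.-) (_ , Sign.+ , _) = refl
  J-flip (_ , _ , Sign.-) (_ , Sign.- , _) = refl

  -- The three sign products pair up the three edge-ends at one vertex, so their product is a
  -- square and an odd number of them is +.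
  J-triangle : ∀ x y z → J y x xor (J z x xor J y (flipStep z)) ≡ true
  J-triangle (_ , Sign.+ , _) (_ , _ , Sign.+) (_ , _ , Sign.+) = refl
  J-triangle (_ , Sign.+ , _) (_ , _ , Sign.+) (_ , _ , Sign.-) = refl
  J-triangle (_ , Sign.+ , _) (_ , _ , Sign.-) (_ , _ , Sign.+) = refl
  J-triangle (_ , Sign.+ , _) (_ , _ , Sign.-) (_ , _ , Sign.-) = refl
  J-triangle (_ , Sign.- , _) (_ , _ , Sign.+) (_ , _ , Sign.+) = refl
  J-triangle (_ , Sign.- , _) (_ , _ , Sign.+) (_ , _ , Sign.-) = refl
  J-triangle (_ , Sign.- , _) (_ , _ , Sign.-) (_ , _ , Sign.+) = refl
  J-triangle (_ , Sign.- , _) (_ , _ , Sign.-) (_ , _ , Sign.-) = refl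

  junction-∷ʳ : ∀ xs y z zs → junction (xs ∷ʳ y) (z ∷ zs) ≡ J y z
  junction-∷ʳ []            y z zs = refl
  junction-∷ʳ (x ∷ [])      y z zs = refl
  junction-∷ʳ (x ∷ x′ ∷ xs) y z zs = junction-∷ʳ (x′ ∷ xs) y z zs

  reverseSteps-∷ : ∀ x L → reverseSteps (x ∷ L) ≡ reverseSteps L ∷ʳ flipStep x
  reverseSteps-∷ x L = List.unfold-reverse (flipStep x) (map flipStep L)

  reverseSteps-∷ʳ : ∀ L z → reverseSteps (L ∷ʳ z) ≡ flipStep z ∷ reverseSteps L
  reverseSteps-∷ʳ L z = trans (cong reverse (List.map-++ flipStep L (z ∷ [])))
                              (List.reverse-++ (map flipStep L) (flipStep z ∷ []))

  junction-reverseSteps : ∀ x L → junction (reverseSteps L) (flipStep x ∷ []) ≡ junction (x ∷ []) L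
  junction-reverseSteps x []      = refl
  junction-reverseSteps x (y ∷ L) = begin
    junction (reverseSteps (y ∷ L)) (flipStep x ∷ [])
      ≡⟨ cong (λ R → junction R (flipStep x ∷ [])) (reverseSteps-∷ y L) ⟩
    junction (reverseSteps L ∷ʳ flipStep y) (flipStep x ∷ [])
      ≡⟨ junction-∷ʳ (reverseSteps L) (flipStep y) (flipStep x) [] ⟩
    J (flipStep y) (flipStep x)
      ≡⟨ J-flip x y ⟩
    J x y ∎
    where open ≡-Reasoning

  parity-flags-reverseSteps : ∀ L → parity (flags (reverseSteps L)) ≡ parity (flags L)
  parity-flags-reverseSteps []      = refl
  parity-flags-reverseSteps (x ∷ L) = begin
    parity (flags (reverseSteps (x ∷ L)))
      ≡⟨ cong (parity ∘ flags) (reverseSteps-∷ x L) ⟩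
    parity (flags (reverseSteps L ∷ʳ flipStep x))
      ≡⟨ parity-flags-++ (reverseSteps L) (flipStep x ∷ []) ⟩
    (parity (flags (reverseSteps L)) xor junction (reverseSteps L) (flipStep x ∷ [])) xor false
      ≡⟨ xor-identityʳ _ ⟩
    parity (flags (reverseSteps L)) xor junction (reverseSteps L) (flipStep x ∷ [])
      ≡⟨ cong₂ _xor_ (parity-flags-reverseSteps L) (junction-reverseSteps x L) ⟩
    parity (flags L) xor junction (x ∷ []) L
      ≡⟨ xor-comm (parity (flags L)) (junction (x ∷ []) L) ⟩
    junction (x ∷ []) L xor parity (flags L)
      ≡⟨ parity-flags-++ (x ∷ []) L ⟨
    parity (flags (x ∷ L)) ∎
    where open ≡-Reasoning

  exponents-reverseSteps : ∀ L →
    exponents (reverseSteps L) ≡ swapIf (parity (flags L)) (exponents L)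
  exponents-reverseSteps []      = refl
  exponents-reverseSteps (x ∷ L) = begin
    exponents (reverseSteps (x ∷ L))
      ≡⟨ cong exponents (reverseSteps-∷ x L) ⟩
    exponents (reverseSteps L ∷ʳ flipStep x)
      ≡⟨ exponents-++ (reverseSteps L) (flipStep x ∷ []) ⟩
    exponents (reverseSteps L) ⊞
      swapIf (entryParity (reverseSteps L) (flipStep x ∷ [])) (exponents (x ∷ []))
      ≡⟨ cong₂ (λ P b → P ⊞ swapIf b (exponents (x ∷ [])))
               (exponents-reverseSteps L)
               (cong₂ _xor_ (parity-flags-reverseSteps L) (junction-reverseSteps x L)) ⟩
    swapIf π (exponents L) ⊞ swapIf (π xor j) (exponents (x ∷ []))
      ≡⟨ ⊞-comm (swapIf π (exponents L)) _ ⟩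
    swapIf (π xor j) (exponents (x ∷ [])) ⊞ swapIf π (exponents L)
      ≡⟨ cong₂ _⊞_ (cong (λ b → swapIf b (exponents (x ∷ []))) (xor-comm π j))
                   (sym (swapIf-xor-cancel π j (exponents L))) ⟩
    swapIf (j xor π) (exponents (x ∷ [])) ⊞ swapIf (j xor π) (swapIf j (exponents L))
      ≡⟨ swapIf-⊞ (j xor π) _ _ ⟨
    swapIf (j xor π) (exponents (x ∷ []) ⊞ swapIf j (exponents L))
      ≡⟨ cong₂ swapIf (parity-flags-++ (x ∷ []) L) (exponents-++ (x ∷ []) L) ⟨
    swapIf (parity (flags (x ∷ L))) (exponents (x ∷ L)) ∎
    where
    open ≡-Reasoning
    π = parity (flags L)
    j = junction (x ∷ []) L

  exponents-++-reverseSteps : ∀ xs ys → exponents (xs ++ reverseSteps ys) ≡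
    exponents xs ⊞ swapIf (entryParity xs (reverseSteps ys) xor parity (flags ys)) (exponents ys)
  exponents-++-reverseSteps xs ys =
    trans (exponents-++ xs (reverseSteps ys))
          (cong (exponents xs ⊞_) (trans (cong (swapIf π) (exponents-reverseSteps ys))
                                          (swapIf-swapIf π (parity (flags ys)) (exponents ys))))
    where π = entryParity xs (reverseSteps ys)

  last-∷ʳ : ∀ x xs y → last G x (xs ∷ʳ y) ≡ y
  last-∷ʳ x []       y = refl
  last-∷ʳ x (x′ ∷ xs) y = last-∷ʳ x′ xs y

  closedFlags-∷-∷ʳ : ∀ x M y → closedFlags G (x ∷ M ∷ʳ y) ≡ J y x ∷ flags (x ∷ M ∷ʳ y)
  closedFlags-∷-∷ʳ x []      y = refl
  closedFlags-∷-∷ʳ x (z ∷ M) y = cong (λ l → J l x ∷ flags (x ∷ z ∷ M ∷ʳ y)) (last-∷ʳ z M y)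

  closing-junction : ∀ x X Y y → parity (closedFlags G ((x ∷ X) ++ (Y ∷ʳ y))) ≡ false →
    J y x ≡ entryParity (x ∷ X) (Y ∷ʳ y) xor parity (flags (Y ∷ʳ y))
  closing-junction x X Y y even = xor≡false⇒≡ (begin
    J y x xor (entryParity (x ∷ X) (Y ∷ʳ y) xor parity (flags (Y ∷ʳ y)))
      ≡⟨ cong (J y x xor_) (parity-flags-++ (x ∷ X) (Y ∷ʳ y)) ⟨
    parity (J y x ∷ flags ((x ∷ X) ++ (Y ∷ʳ y)))
      ≡⟨ cong parity closedFlags≡ ⟨
    parity (closedFlags G ((x ∷ X) ++ (Y ∷ʳ y)))
      ≡⟨ even ⟩
    false ∎)
    where
    open ≡-Reasoning
    closedFlags≡ : closedFlags G ((x ∷ X) ++ (Y ∷ʳ y)) ≡ J y x ∷ flags ((x ∷ X) ++ (Y ∷ʳ y))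
    closedFlags≡ = subst (λ L → closedFlags G (x ∷ L) ≡ J y x ∷ flags (x ∷ L))
                         (List.++-assoc X Y (y ∷ [])) (closedFlags-∷-∷ʳ x (X ++ Y) y)

  entryParities-opposite : ∀ x X Y y Z z →
    parity (closedFlags G ((x ∷ X) ++ (Y ∷ʳ y))) ≡ false →
    parity (closedFlags G ((x ∷ X) ++ (Z ∷ʳ z))) ≡ false →
    entryParity (x ∷ X) (Y ∷ʳ y) xor
      (entryParity (x ∷ X) (Z ∷ʳ z) xor
        (entryParity (Y ∷ʳ y) (reverseSteps (Z ∷ʳ z)) xor parity (flags (Z ∷ʳ z)))) ≡ true
  entryParities-opposite x X Y y Z z even₁ even₂ = begin
    π₁ xor (π₂ xor ((I₁ xor q) xor I₂))  ≡⟨ xor-regroup π₁ π₂ I₁ I₂ q ⟩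
    (π₁ xor I₁) xor ((π₂ xor I₂) xor q)  ≡⟨ cong₂ (λ k₁ k₂ → k₁ xor (k₂ xor q))
                                                   (closing-junction x X Y y even₁)
                                                   (closing-junction x X Z z even₂) ⟨
    J y x xor (J z x xor q)              ≡⟨ cong (λ b → J y x xor (J z x xor b)) q≡ ⟩
    J y x xor (J z x xor J y (flipStep z)) ≡⟨ J-triangle x y z ⟩
    true                                 ∎
    where
    open ≡-Reasoning
    π₁ = entryParity (x ∷ X) (Y ∷ʳ y)
    π₂ = entryParity (x ∷ X) (Z ∷ʳ z)
    I₁ = parity (flags (Y ∷ʳ y))
    I₂ = parity (flags (Z ∷ʳ z))
    q  = junction (Y ∷ʳ y) (reverseSteps (Z ∷ʳ z))
    q≡ : q ≡ J y (flipStep z)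
    q≡ = trans (cong (junction (Y ∷ʳ y)) (reverseSteps-∷ʳ Z z)) (junction-∷ʳ Y y (flipStep z) _)

  -- The first three alternatives are the cases of a trivial w, w₁ or w₂.
  admissible : ∀ Sw S₁ S₂ →
    parity (closedFlags G (Sw ++ S₁)) ≡ false → parity (closedFlags G (Sw ++ S₂)) ≡ false →
    proj₁ (exponents Sw) ≡ 0ᵥ ⊎ exponents S₁ ≡ 𝟘 ⊎ exponents S₂ ≡ 𝟘 ⊎
    entryParity Sw S₁ xor
      (entryParity Sw S₂ xor (entryParity S₁ (reverseSteps S₂) xor parity (flags S₂))) ≡ true
  admissible []      _  _  _ _ = inj₁ refl
  admissible (x ∷ X) S₁ S₂ even₁ even₂ with initLast S₁ | initLast S₂
  ... | []      | _       = inj₂ (inj₁ refl)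
  ... | _ ∷ʳ′ _ | []      = inj₂ (inj₂ (inj₁ refl))
  ... | Y ∷ʳ′ y | Z ∷ʳ′ z = inj₂ (inj₂ (inj₂ (entryParities-opposite x X Y y Z z even₁ even₂)))

  steps-binomial-∈-ideal : ∀ Sw S₁ S₂ → count G (flags Sw) ≡ 0 →
    parity (closedFlags G (Sw ++ S₁)) ≡ false → parity (closedFlags G (Sw ++ S₂)) ≡ false →
    InIdeal₂ (binomial (exponents (S₁ ++ reverseSteps S₂)))
             (binomial (exponents (Sw ++ S₁))) (binomial (exponents (Sw ++ S₂)))
  steps-binomial-∈-ideal Sw S₁ S₂ noFlags even₁ even₂ =
    InIdeal₂-resp-≡ (exponents (S₁ ++ reverseSteps S₂))
                    (exponents (Sw ++ S₁)) (exponents (Sw ++ S₂))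
      (exponents-++-reverseSteps S₁ S₂)
      (exponents-++-noFlags Sw S₁ noFlags) (exponents-++-noFlags Sw S₂ noFlags)
      (binomial-∈-ideal (proj₁ (exponents Sw)) (entryParity Sw S₁) (entryParity Sw S₂)
        (entryParity S₁ (reverseSteps S₂) xor parity (flags S₂)) (exponents S₁) (exponents S₂)
        (admissible Sw S₁ S₂ even₁ even₂))

  steps-+w : ∀ {u v w} (a : Walk G u v) (b : Walk G v w) →
             steps G (_+w_ G a b) ≡ steps G a ++ steps G b
  steps-+w []            b = refl
  steps-+w (e ∷⟨ j ⟩ a) b = cong (_ ∷_) (steps-+w a b)

  steps-rev : ∀ {u v} (a : Walk G u v) → steps G (rev G a) ≡ reverseSteps (steps G a)
  steps-rev []            = refl
  steps-rev (e ∷⟨ j ⟩ a) = begin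
    steps G (_+w_ G (rev G a) _)      ≡⟨ steps-+w (rev G a) _ ⟩
    steps G (rev G a) ++ (_ ∷ [])     ≡⟨ cong (_++ _) (steps-rev a) ⟩
    reverseSteps (steps G a) ∷ʳ _     ≡⟨ reverseSteps-∷ _ (steps G a) ⟨
    reverseSteps (steps G (e ∷⟨ j ⟩ a)) ∎
    where open ≡-Reasoning

  isEven-+w⇒parity≡false : ∀ {u v} (a : Walk G u v) (b : Walk G v u) → IsEven G (_+w_ G a b) →
                           parity (closedFlags G (steps G a ++ steps G b)) ≡ false
  isEven-+w⇒parity≡false a b (k , even) =
    subst (λ L → parity (closedFlags G L) ≡ false) (steps-+w a b)
          (even-count⇒parity≡false (closedFlags G (steps G (_+w_ G a b))) k even)

lemma4p4 : ∀ {c ℓ} (K : Field c ℓ) (G : SignedGraph)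
    {u v : Fin (SignedGraph.n G)}
    (w : Walk G u v) (w₁ w₂ : Walk G v u) →
    NoUnbalanced G w →
    IsEven G (_+w_ G w w₁) →
    IsEven G (_+w_ G w w₂) →
    Poly.InIdeal₂ K (SignedGraph.m G)
      (B K G (_+w_ G w₁ (rev G w₂)))
      (B K G (_+w_ G w w₁))
      (B K G (_+w_ G w w₂))
lemma4p4 K G w w₁ w₂ noUnbalanced even₁ even₂ =
  InIdeal₂-resp-≡ (exponents (steps G (_+w_ G w₁ (rev G w₂))))
                  (exponents (steps G (_+w_ G w w₁))) (exponents (steps G (_+w_ G w w₂)))
    (cong exponents (trans (steps-+w w₁ (rev G w₂)) (cong (steps G w₁ ++_) (steps-rev w₂))))
    (cong exponents (steps-+w w w₁)) (cong exponents (steps-+w w w₂))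
    (steps-binomial-∈-ideal (steps G w) (steps G w₁) (steps G w₂) noUnbalanced
      (isEven-+w⇒parity≡false w w₁ even₁) (isEven-+w⇒parity≡false w w₂ even₂))
  where
  open Sections K G
  open BinomialIdeals K (SignedGraph.m G) using (InIdeal₂-resp-≡)
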